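{- Let $\mathbb A$ be a coherent algebra of matrices indexed by a finite set $X$, and let $\mathcal G$ be the set of all pairs $(G,R)$ where $G$ is a two-terminal series-parallel graph with terminals $r_1,r_2$ and $R=(r_1,r_2)$. Then $$\mathbb A=\bigcup_{(G,R)\in\mathcal G}\mathbf W((G,R);\mathbb A).$$
   Context: A coherent algebra is a complex vector space $\mathbb A$ of matrices with rows and columns indexed by $X$, closed under ordinary product, entrywise product, transpose and entrywise conjugation, containing $I$ and the all-ones matrix $J$. A two-terminal series-parallel graph is a finite multigraph with two distinguished nodes $r_1,r_2$ that can be reduced, by some sequence of series reductions (replacing a non-distinguished node of degree two and its two incident edges by a single edge joining its two neighbours) and parallel reductions (replacing two parallel edges by one edge), to a graph whose only nodes are $r_1,r_2$. For a graph $G$ and root list $R$, $\mathbf W((G,R);\mathbb A)$ is the span of all $\mathsf S(G,R;w)=\sum_{\varphi:V(G)\to X}\big(\prod_{e=(a,b)\in E(G)}w(e)_{\varphi(a),\varphi(b)}\big)\widehat{\varphi(r_1)}\otimes\widehat{\varphi(r_2)}$ with $w:E(G)\to\mathbb A$ (edges oriented arbitrarily), second-order tensors being identified with matrices via $M\leftrightarrow\sum_{x,y}M_{xy}\hat x\otimes\hat y$. -}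

module Defs where

open import Level using (Level; _⊔_)
open import Data.Nat using (ℕ; zero; suc)
open import Data.Fin using (Fin; zero; suc; punchIn; _≟_)
open import Data.Product using (Σ; _×_; _,_; swap)
open import Data.Sum using (_⊎_)
open import Data.List using (List; []; _∷_; length; map)
open import Data.List.Relation.Binary.Permutation.Propositional using (_↭_)
open import Relation.Nullary using (yes; no)
open import Relation.Binary.PropositionalEquality using (_≡_; _≢_)
open import Relation.Binary.Construct.Closure.ReflexiveTransitive using (Star)
open import Algebra.Bundles using (CommutativeRing)

-- A finite multigraph on nodes Fin n, edges given as an (oriented) list
-- (multiplicity = number of occurrences), with two distinguished nodes.
record TTGraph : Set where
  constructor mkG
  field
    n     : ℕ
    edges : List (Fin n × Fin n)
    r₁    : Fin n
    r₂    : Fin n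
open TTGraph public

punchIn² : ∀ {n} → Fin (suc n) → Fin n × Fin n → Fin (suc n) × Fin (suc n)
punchIn² u (a , b) = (punchIn u a , punchIn u b)

IncidentVia : ∀ {n} → Fin (suc n) → Fin n → Fin (suc n) × Fin (suc n) → Set
IncidentVia u a e = (e ≡ (punchIn u a , u)) ⊎ (e ≡ (u , punchIn u a))

Parallel : ∀ {n} → Fin n × Fin n → Fin n × Fin n → Set
Parallel e e' = (e' ≡ e) ⊎ (e' ≡ swap e)

-- One reduction step.
-- series: node u (not a terminal, since the terminals are punchIn u r)
--   has exactly two incident edges e₁, e₂ (all other edges avoid u),
--   joining it to neighbours a, b; u and e₁, e₂ are replaced by an edge a—b
--   (u is deleted, the remaining nodes being renumbered via punchIn u).
-- parallel: two parallel edges e, e' are replaced by one edge e.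
data Reduction : TTGraph → TTGraph → Set where
  series : ∀ {n} (u : Fin (suc n)) (a b r₁' r₂' : Fin n)
             (E : List (Fin (suc n) × Fin (suc n)))
             (E' : List (Fin n × Fin n))
             (e₁ e₂ : Fin (suc n) × Fin (suc n)) →
             IncidentVia u a e₁ → IncidentVia u b e₂ →
             E ↭ (e₁ ∷ e₂ ∷ map (punchIn² u) E') →
             Reduction (mkG (suc n) E (punchIn u r₁') (punchIn u r₂'))
                       (mkG n ((a , b) ∷ E') r₁' r₂')
  parallel : ∀ {n} (E E' : List (Fin n × Fin n)) (e e' : Fin n × Fin n)
               (s₁ s₂ : Fin n) →
               Parallel e e' → E ↭ (e ∷ e' ∷ E') →
               Reduction (mkG n E s₁ s₂) (mkG n (e ∷ E') s₁ s₂)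

IsSeriesParallel : TTGraph → Set
IsSeriesParallel G =
  Σ TTGraph λ H → Star Reduction G H × (n H ≡ 2) × (r₁ H ≢ r₂ H)

module _ {c ℓ} (R : CommutativeRing c ℓ) where
  open CommutativeRing R hiding (zero)

  -- "entrywise conjugation": an involutive ring automorphism of the scalars
  record Involution : Set (c ⊔ ℓ) where
    field
      conj       : Carrier → Carrier
      conj-cong  : ∀ {x y} → x ≈ y → conj x ≈ conj y
      conj-+     : ∀ x y → conj (x + y) ≈ conj x + conj y
      conj-*     : ∀ x y → conj (x * y) ≈ conj x * conj y
      conj-1     : conj 1# ≈ 1#
      conj-invol : ∀ x → conj (conj x) ≈ x

  Mat : ℕ → Set c
  Mat m = Fin m → Fin m → Carrier

  _≈ᴹ_ : ∀ {m} → Mat m → Mat m → Set ℓ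
  M ≈ᴹ N = ∀ i j → M i j ≈ N i j

  sumFin : ∀ {m} → (Fin m → Carrier) → Carrier
  sumFin {zero}  f = 0#
  sumFin {suc m} f = f zero + sumFin (λ i → f (suc i))

  consF : ∀ {k m} → Fin m → (Fin k → Fin m) → Fin (suc k) → Fin m
  consF x φ zero    = x
  consF x φ (suc i) = φ i

  sumMaps : ∀ k {m} → ((Fin k → Fin m) → Carrier) → Carrier
  sumMaps zero    f = f (λ ())
  sumMaps (suc k) f = sumFin (λ x → sumMaps k (λ φ → f (consF x φ)))

  δ : ∀ {m} → Fin m → Fin m → Carrier
  δ i j with i ≟ j
  ... | yes _ = 1#
  ... | no  _ = 0#

  0ᴹ Iᴹ Jᴹ : ∀ {m} → Mat m
  0ᴹ i j = 0#
  Iᴹ i j = δ i j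
  Jᴹ i j = 1#

  _+ᴹ_ _*ᴹ_ _∘ᴴ_ : ∀ {m} → Mat m → Mat m → Mat m
  (M +ᴹ N) i j = M i j + N i j
  (M *ᴹ N) i j = sumFin (λ k → M i k * N k j)
  (M ∘ᴴ N) i j = M i j * N i j

  _·ᴹ_ : ∀ {m} → Carrier → Mat m → Mat m
  (a ·ᴹ M) i j = a * M i j

  _ᵀ : ∀ {m} → Mat m → Mat m
  (M ᵀ) i j = M j i

  sumᴹ : ∀ {k m} → (Fin k → Mat m) → Mat m
  sumᴹ {zero}  f = 0ᴹ
  sumᴹ {suc k} f = f zero +ᴹ sumᴹ (λ i → f (suc i))

  record IsCoherentAlgebra {ℓa} (ι : Involution) (m : ℕ)
                           (A : Mat m → Set ℓa) : Set (c ⊔ ℓ ⊔ ℓa) where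
    open Involution ι
    field
      resp   : ∀ {M N} → M ≈ᴹ N → A M → A N
      0∈     : A 0ᴹ
      +∈     : ∀ {M N} → A M → A N → A (M +ᴹ N)
      ·∈     : ∀ a {M} → A M → A (a ·ᴹ M)
      *∈     : ∀ {M N} → A M → A N → A (M *ᴹ N)
      ∘∈     : ∀ {M N} → A M → A N → A (M ∘ᴴ N)
      ᵀ∈     : ∀ {M} → A M → A (M ᵀ)
      conj∈  : ∀ {M} → A M → A (λ i j → conj (M i j))
      I∈     : A Iᴹ
      J∈     : A Jᴹ

  edgeProd : ∀ {k m} (E : List (Fin k × Fin k)) →
             (Fin (length E) → Mat m) → (Fin k → Fin m) → Carrier
  edgeProd []            w φ = 1#
  edgeProd ((a , b) ∷ E) w φ = w zero (φ a) (φ b) * edgeProd E (λ i → w (suc i)) φ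

  Weights : ℕ → TTGraph → Set c
  Weights m G = Fin (length (edges G)) → Mat m

  S : ∀ {m} (G : TTGraph) → Weights m G → Mat m
  S G w x y = sumMaps (n G) (λ φ →
                δ (φ (r₁ G)) x * (δ (φ (r₂ G)) y * edgeProd (edges G) w φ))

  W : ∀ {ℓa} (m : ℕ) (G : TTGraph) (A : Mat m → Set ℓa) → Mat m →
      Set (c ⊔ ℓ ⊔ ℓa)
  W m G A M =
    Σ ℕ λ k → Σ (Fin k → Carrier) λ coef → Σ (Fin k → Weights m G) λ ws →
      (∀ i e → A (ws i e)) × (M ≈ᴹ sumᴹ (λ i → coef i ·ᴹ S G (ws i)))

-- Every M in 𝔸 is S(K₂, (r₁, r₂); M) for the single edge K₂. Conversely, reductions act on
-- 𝔸-valued weights without changing S: a parallel reduction merges the two weights by the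
-- entrywise product (transposing one if the edges point oppositely), and a series reduction
-- sums out the degree-two node, merging the weights by the matrix product. On the final
-- graph with nodes r₁, r₂ only, S is an entrywise product of matrices M, Mᵀ, diag(M) J and
-- J diag(M) with M in 𝔸, and these lie in 𝔸 since I ∘ M is diag(M).
module Submission where

open import Level using (_⊔_)
open import Function using (_∘_; flip)
open import Data.Nat using (ℕ; zero; suc)
open import Data.Fin using (Fin; zero; suc; punchIn; _≟_)
open import Data.Fin.Properties using (punchInᵢ≢i)
open import Data.Vec.Functional using (insertAt; removeAt; replicate)
open import Data.Vec.Functional.Properties using (insertAt-lookup; insertAt-punchIn)
open import Data.Product using (Σ; _×_; _,_; proj₁; proj₂)
import Data.Product as Product
open import Data.Sum using (inj₁; inj₂)
open import Data.List using (List; []; _∷_; map; length)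
open import Data.List.Relation.Unary.All using (All; []; _∷_)
open import Data.List.Relation.Unary.All.Properties using (map⁻)
open import Data.List.Relation.Binary.Permutation.Propositional as ↭ using (_↭_)
open import Data.List.Relation.Binary.Permutation.Propositional.Properties using (↭-map-inv; All-resp-↭)
open import Relation.Binary.Core using (_Preserves_⟶_)
open import Relation.Binary.Construct.Closure.ReflexiveTransitive using (Star; ε; _◅_)
open import Relation.Binary.PropositionalEquality using (_≡_; _≢_; _≗_; refl; cong; cong₂)
import Relation.Binary.PropositionalEquality as ≡
open import Relation.Nullary using (yes; no; contradiction)
open import Algebra.Bundles using (CommutativeRing)
import Algebra.Properties.Semiring.Sum as SemiringSum
import Algebra.Properties.CommutativeSemigroup as CommutativeSemigroupProperties
import Relation.Binary.Reasoning.Setoid as SetoidReasoning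
open import Defs

module FiniteSums {c ℓ} (R : CommutativeRing c ℓ) where
  open CommutativeRing R hiding (zero) renaming (refl to ≈-refl)
  open SemiringSum semiring
    using (sum; sum-cong-≋; ∑-comm; *-distribˡ-sum; *-distribʳ-sum; sum-remove; sum-replicate-zero)
  open SetoidReasoning setoid

  sumFin≡sum : ∀ {k} (f : Fin k → Carrier) → sumFin R f ≡ sum f
  sumFin≡sum {zero}  f = refl
  sumFin≡sum {suc k} f = cong (f zero +_) (sumFin≡sum (f ∘ suc))

  sumFin-cong : ∀ {k} {f g : Fin k → Carrier} → (∀ i → f i ≈ g i) → sumFin R f ≈ sumFin R g
  sumFin-cong {f = f} {g} f≈g = begin
    sumFin R f  ≡⟨ sumFin≡sum f ⟩
    sum f       ≈⟨ sum-cong-≋ f≈g ⟩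
    sum g       ≡⟨ sumFin≡sum g ⟨
    sumFin R g  ∎

  sumFin-*ˡ : ∀ {k} a (f : Fin k → Carrier) → sumFin R (λ i → a * f i) ≈ a * sumFin R f
  sumFin-*ˡ a f = begin
    sumFin R (λ i → a * f i)  ≡⟨ sumFin≡sum (λ i → a * f i) ⟩
    sum (λ i → a * f i)       ≈⟨ *-distribˡ-sum a f ⟨
    a * sum f                 ≡⟨ cong (a *_) (sumFin≡sum f) ⟨
    a * sumFin R f            ∎

  sumFin-*ʳ : ∀ {k} a (f : Fin k → Carrier) → sumFin R (λ i → f i * a) ≈ sumFin R f * a
  sumFin-*ʳ a f = begin
    sumFin R (λ i → f i * a)  ≡⟨ sumFin≡sum (λ i → f i * a) ⟩
    sum (λ i → f i * a)       ≈⟨ *-distribʳ-sum a f ⟨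
    sum f * a                 ≡⟨ cong (_* a) (sumFin≡sum f) ⟨
    sumFin R f * a            ∎

  sumFin-comm : ∀ {k l} (f : Fin k → Fin l → Carrier) →
                sumFin R (λ i → sumFin R (f i)) ≈ sumFin R (λ j → sumFin R (λ i → f i j))
  sumFin-comm f = begin
    sumFin R (λ i → sumFin R (f i))           ≈⟨ asDoubleSum f ⟩
    sum (λ i → sum (f i))                     ≈⟨ ∑-comm f ⟩
    sum (λ j → sum (λ i → f i j))             ≈⟨ asDoubleSum (flip f) ⟨
    sumFin R (λ j → sumFin R (λ i → f i j))   ∎
    where
    asDoubleSum : ∀ {k l} (g : Fin k → Fin l → Carrier) →
                  sumFin R (λ i → sumFin R (g i)) ≈ sum (λ i → sum (g i))
    asDoubleSum g = trans (reflexive (sumFin≡sum (λ i → sumFin R (g i))))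
                          (sum-cong-≋ (λ i → reflexive (sumFin≡sum (g i))))

  δ-refl : ∀ {k} (i : Fin k) → δ R i i ≈ 1#
  δ-refl i with i ≟ i
  ... | yes _   = ≈-refl
  ... | no i≢i = contradiction refl i≢i

  δ-≢ : ∀ {k} {i j : Fin k} → i ≢ j → δ R i j ≈ 0#
  δ-≢ {i = i} {j} i≢j with i ≟ j
  ... | yes i≡j = contradiction i≡j i≢j
  ... | no _    = ≈-refl

  δ-sym : ∀ {k} (i j : Fin k) → δ R i j ≈ δ R j i
  δ-sym i j with i ≟ j
  ... | yes refl = sym (δ-refl i)
  ... | no i≢j  = sym (δ-≢ (i≢j ∘ ≡.sym))

  sumFin-δ : ∀ {k} (g : Fin k → Carrier) (x : Fin k) → sumFin R (λ a → δ R a x * g a) ≈ g x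
  sumFin-δ {suc k} g x = begin
    sumFin R t                ≡⟨ sumFin≡sum t ⟩
    sum t                     ≈⟨ sum-remove {i = x} t ⟩
    t x + sum (removeAt t x)  ≈⟨ +-cong (trans (*-congʳ (δ-refl x)) (*-identityˡ (g x))) offDiagonal ⟩
    g x + 0#                  ≈⟨ +-identityʳ (g x) ⟩
    g x                       ∎
    where
    t : Fin (suc k) → Carrier
    t a = δ R a x * g a
    offDiagonal : sum (removeAt t x) ≈ 0#
    offDiagonal = trans (sum-cong-≋ {y = replicate k 0#}
                                    (λ j → trans (*-congʳ (δ-≢ (punchInᵢ≢i x j))) (zeroˡ _)))
                        (sum-replicate-zero k)

  sumFin²-δ : ∀ {k} (g : Fin k → Fin k → Carrier) (x y : Fin k) →
              sumFin R (λ a → sumFin R (λ b → δ R a x * (δ R b y * g a b))) ≈ g x y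
  sumFin²-δ g x y = begin
    sumFin R (λ a → sumFin R (λ b → δ R a x * (δ R b y * g a b)))
      ≈⟨ sumFin-cong (λ a → trans (sumFin-*ˡ (δ R a x) (λ b → δ R b y * g a b)) (*-congˡ (sumFin-δ (g a) y))) ⟩
    sumFin R (λ a → δ R a x * g a y)
      ≈⟨ sumFin-δ (λ a → g a y) x ⟩
    g x y ∎

  module _ {m : ℕ} where

    sumMaps-cong : ∀ k {f g : (Fin k → Fin m) → Carrier} → (∀ φ → f φ ≈ g φ) →
                   sumMaps R k f ≈ sumMaps R k g
    sumMaps-cong zero    f≈g = f≈g _
    sumMaps-cong (suc k) f≈g = sumFin-cong (λ x → sumMaps-cong k (λ φ → f≈g (consF R x φ)))

    sumFin-sumMaps-comm : ∀ k (f : Fin m → (Fin k → Fin m) → Carrier) →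
                          sumFin R (λ v → sumMaps R k (f v)) ≈
                          sumMaps R k (λ φ → sumFin R (λ v → f v φ))
    sumFin-sumMaps-comm zero    f = ≈-refl
    sumFin-sumMaps-comm (suc k) f =
      trans (sumFin-comm (λ v x → sumMaps R k (λ φ → f v (consF R x φ))))
            (sumFin-cong (λ x → sumFin-sumMaps-comm k (λ v φ → f v (consF R x φ))))

    consF-cong : ∀ {k} x {φ ψ : Fin k → Fin m} → φ ≗ ψ → consF R x φ ≗ consF R x ψ
    consF-cong x φ≗ψ zero    = refl
    consF-cong x φ≗ψ (suc i) = φ≗ψ i

    -- consF and insertAt build the same valuations only pointwise, hence the hypothesis on f.
    sumMaps-insertAt : ∀ k (u : Fin (suc k)) {f : (Fin (suc k) → Fin m) → Carrier} →
                       f Preserves _≗_ ⟶ _≈_ →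
                       sumMaps R (suc k) f ≈ sumMaps R k (λ ψ → sumFin R (λ v → f (insertAt ψ u v)))
    sumMaps-insertAt k zero {f} f-ext =
      trans (sumFin-sumMaps-comm k (λ v ψ → f (consF R v ψ)))
            (sumMaps-cong k (λ ψ → sumFin-cong (λ v → f-ext (consF≗insertAt₀ v ψ))))
      where
      consF≗insertAt₀ : ∀ v ψ → consF R v ψ ≗ insertAt ψ zero v
      consF≗insertAt₀ v ψ zero    = refl
      consF≗insertAt₀ v ψ (suc i) = refl
    sumMaps-insertAt (suc k) (suc u) {f} f-ext = sumFin-cong λ x →
      trans (sumMaps-insertAt k u (f-ext ∘ consF-cong x))
            (sumMaps-cong k (λ ψ → sumFin-cong (λ v → f-ext (consF≗insertAtₛ x v ψ))))
      where
      consF≗insertAtₛ : ∀ x v ψ → consF R x (insertAt ψ u v) ≗ insertAt (consF R x ψ) (suc u) v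
      consF≗insertAtₛ x v ψ zero    = refl
      consF≗insertAtₛ x v ψ (suc i) = refl

module RootedSums {c ℓ} (R : CommutativeRing c ℓ) (m : ℕ) where
  open CommutativeRing R hiding (zero) renaming (refl to ≈-refl)
  open CommutativeSemigroupProperties *-commutativeSemigroup using (x∙yz≈y∙xz)
  open FiniteSums R
  open SetoidReasoning setoid

  Valuation : ℕ → Set
  Valuation k = Fin k → Fin m

  -- S R G w is definitionally rootedSum (n G) (r₁ G) (r₂ G) (edgeProd R (edges G) w).
  rootedSum : ∀ k → Fin k → Fin k → (Valuation k → Carrier) → Mat R m
  rootedSum k s₁ s₂ f x y = sumMaps R k (λ φ → δ R (φ s₁) x * (δ R (φ s₂) y * f φ))

  rootedSum-cong : ∀ k s₁ s₂ {f g : Valuation k → Carrier} → (∀ φ → f φ ≈ g φ) →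
                   _≈ᴹ_ R (rootedSum k s₁ s₂ f) (rootedSum k s₁ s₂ g)
  rootedSum-cong k s₁ s₂ f≈g x y = sumMaps-cong k (λ φ → *-congˡ (*-congˡ (f≈g φ)))

  rootedSum-swap : ∀ k s₁ s₂ (f : Valuation k → Carrier) →
                   _≈ᴹ_ R (rootedSum k s₂ s₁ f) (_ᵀ R (rootedSum k s₁ s₂ f))
  rootedSum-swap k s₁ s₂ f x y = sumMaps-cong k (λ φ → x∙yz≈y∙xz (δ R (φ s₂) x) (δ R (φ s₁) y) (f φ))

  pair : Fin m → Fin m → Valuation 2
  pair x y = consF R x (consF R y (λ ()))

  -- pair agrees only pointwise with the valuations enumerated by sumMaps: two absurd
  -- lambdas are not definitionally equal.
  rootedSum-two : ∀ {f : Valuation 2 → Carrier} → f Preserves _≗_ ⟶ _≈_ →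
                  ∀ x y → rootedSum 2 zero (suc zero) f x y ≈ f (pair x y)
  rootedSum-two {f} f-ext x y = begin
    rootedSum 2 zero (suc zero) f x y
      ≈⟨ sumFin-cong (λ a → sumFin-cong (λ b → *-congˡ (*-congˡ (f-ext (pair≗ a b))))) ⟩
    sumFin R (λ a → sumFin R (λ b → δ R a x * (δ R b y * f (pair a b))))
      ≈⟨ sumFin²-δ (λ a b → f (pair a b)) x y ⟩
    f (pair x y) ∎
    where
    pair≗ : ∀ a b → consF R a (consF R b (λ ())) ≗ pair a b
    pair≗ a b zero       = refl
    pair≗ a b (suc zero) = refl

  rootedSum-insertAt : ∀ k (u : Fin (suc k)) s₁ s₂ {f : Valuation (suc k) → Carrier} →
                       f Preserves _≗_ ⟶ _≈_ →
                       _≈ᴹ_ R (rootedSum (suc k) (punchIn u s₁) (punchIn u s₂) f)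
                             (rootedSum k s₁ s₂ (λ ψ → sumFin R (λ v → f (insertAt ψ u v))))
  rootedSum-insertAt k u s₁ s₂ {f} f-ext x y = begin
    sumMaps R (suc k) F
      ≈⟨ sumMaps-insertAt k u F-ext ⟩
    sumMaps R k (λ ψ → sumFin R (λ v → F (insertAt ψ u v)))
      ≈⟨ sumMaps-cong k pullOutRoots ⟩
    rootedSum k s₁ s₂ (λ ψ → sumFin R (λ v → f (insertAt ψ u v))) x y ∎
    where
    F : Valuation (suc k) → Carrier
    F φ = δ R (φ (punchIn u s₁)) x * (δ R (φ (punchIn u s₂)) y * f φ)
    F-ext : F Preserves _≗_ ⟶ _≈_
    F-ext φ≗ψ = *-cong (reflexive (cong (λ z → δ R z x) (φ≗ψ _)))
                       (*-cong (reflexive (cong (λ z → δ R z y) (φ≗ψ _))) (f-ext φ≗ψ))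
    pullOutRoots : ∀ ψ → sumFin R (λ v → F (insertAt ψ u v)) ≈
                         δ R (ψ s₁) x * (δ R (ψ s₂) y * sumFin R (λ v → f (insertAt ψ u v)))
    pullOutRoots ψ = begin
      sumFin R (λ v → F (insertAt ψ u v))
        ≈⟨ sumFin-cong (λ v → *-cong (rootValue s₁ x v) (*-congʳ (rootValue s₂ y v))) ⟩
      sumFin R (λ v → δ R (ψ s₁) x * (δ R (ψ s₂) y * f (insertAt ψ u v)))
        ≈⟨ sumFin-*ˡ (δ R (ψ s₁) x) (λ v → δ R (ψ s₂) y * f (insertAt ψ u v)) ⟩
      δ R (ψ s₁) x * sumFin R (λ v → δ R (ψ s₂) y * f (insertAt ψ u v))
        ≈⟨ *-congˡ (sumFin-*ˡ (δ R (ψ s₂) y) (λ v → f (insertAt ψ u v))) ⟩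
      δ R (ψ s₁) x * (δ R (ψ s₂) y * sumFin R (λ v → f (insertAt ψ u v))) ∎
      where
      rootValue : ∀ s z v → δ R (insertAt ψ u v (punchIn u s)) z ≈ δ R (ψ s) z
      rootValue s z v = reflexive (cong (λ t → δ R t z) (insertAt-punchIn ψ u v s))

  WeightedEdge : ℕ → Set c
  WeightedEdge k = (Fin k × Fin k) × Mat R m

  keys : ∀ {k} → List (WeightedEdge k) → List (Fin k × Fin k)
  keys = map proj₁

  weightProd : ∀ {k} → List (WeightedEdge k) → Valuation k → Carrier
  weightProd []                  φ = 1#
  weightProd (((a , b) , M) ∷ L) φ = M (φ a) (φ b) * weightProd L φ

  weightProd-cong : ∀ {k} (L : List (WeightedEdge k)) {φ ψ : Valuation k} → φ ≗ ψ →
                    weightProd L φ ≡ weightProd L ψ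
  weightProd-cong []                  φ≗ψ = refl
  weightProd-cong (((a , b) , M) ∷ L) φ≗ψ = cong₂ _*_ (cong₂ M (φ≗ψ a) (φ≗ψ b)) (weightProd-cong L φ≗ψ)

  weightProd-ext : ∀ {k} (L : List (WeightedEdge k)) → weightProd L Preserves _≗_ ⟶ _≈_
  weightProd-ext L = reflexive ∘ weightProd-cong L

  weightProd-↭ : ∀ {k} {L L′ : List (WeightedEdge k)} → L ↭ L′ → ∀ φ → weightProd L φ ≈ weightProd L′ φ
  weightProd-↭ ↭.refl          φ = ≈-refl
  weightProd-↭ (↭.prep _ p)    φ = *-congˡ (weightProd-↭ p φ)
  weightProd-↭ (↭.swap _ _ p)  φ = trans (*-congˡ (*-congˡ (weightProd-↭ p φ))) (x∙yz≈y∙xz _ _ _)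
  weightProd-↭ (↭.trans p q)   φ = trans (weightProd-↭ p φ) (weightProd-↭ q φ)

  relabel : ∀ {k l} → (Fin k → Fin l) → WeightedEdge k → WeightedEdge l
  relabel f (e , M) = (Product.map f f e , M)

  weightProd-relabel : ∀ {k l} (f : Fin k → Fin l) (L : List (WeightedEdge k)) φ →
                       weightProd (map (relabel f) L) φ ≡ weightProd L (φ ∘ f)
  weightProd-relabel f []      φ = refl
  weightProd-relabel f (e ∷ L) φ = cong (_ *_) (weightProd-relabel f L φ)

  ∷-keys-inv : ∀ {k} {L : List (WeightedEdge k)} {e K} → keys L ≡ e ∷ K →
               Σ (Mat R m) λ M → Σ (List (WeightedEdge k)) λ L′ → L ≡ (e , M) ∷ L′ × keys L′ ≡ K
  ∷-keys-inv {L = (_ , M) ∷ L′} refl = M , L′ , refl , refl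

  keys-relabel-inv : ∀ {k l} (f : Fin k → Fin l) (E : List (Fin k × Fin k)) {L : List (WeightedEdge l)} →
                     keys L ≡ map (Product.map f f) E →
                     Σ (List (WeightedEdge k)) λ L′ → keys L′ ≡ E × L ≡ map (relabel f) L′
  keys-relabel-inv f []      {[]} refl = [] , refl , refl
  keys-relabel-inv f (e ∷ E) eq with ∷-keys-inv eq
  ... | M , L , refl , keys≡ with keys-relabel-inv f E keys≡
  ... | L′ , refl , refl = (e , M) ∷ L′ , refl , refl

  zipWeights : ∀ {k} (E : List (Fin k × Fin k)) → (Fin (length E) → Mat R m) → List (WeightedEdge k)
  zipWeights []      w = []
  zipWeights (e ∷ E) w = (e , w zero) ∷ zipWeights E (w ∘ suc)

  keys-zipWeights : ∀ {k} (E : List (Fin k × Fin k)) w → keys (zipWeights E w) ≡ E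
  keys-zipWeights []      w = refl
  keys-zipWeights (e ∷ E) w = cong (e ∷_) (keys-zipWeights E (w ∘ suc))

  edgeProd≡weightProd : ∀ {k} (E : List (Fin k × Fin k)) w φ →
                        edgeProd R E w φ ≡ weightProd (zipWeights E w) φ
  edgeProd≡weightProd []      w φ = refl
  edgeProd≡weightProd (e ∷ E) w φ = cong (_ *_) (edgeProd≡weightProd E (w ∘ suc) φ)

  orient : ∀ {k} {d e : Fin k × Fin k} → Parallel d e → Mat R m → Mat R m
  orient (inj₁ _) M = M
  orient (inj₂ _) M = _ᵀ R M

  orient-entry : ∀ {k} {d e : Fin k × Fin k} (p : Parallel d e) (M : Mat R m) (φ : Valuation k) →
                 M (φ (proj₁ e)) (φ (proj₂ e)) ≡ orient p M (φ (proj₁ d)) (φ (proj₂ d))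
  orient-entry (inj₁ refl) M φ = refl
  orient-entry (inj₂ refl) M φ = refl

  weightProd-parallel : ∀ {k} {e e′ : Fin k × Fin k} (p : Parallel e e′) M M′ L φ →
                        weightProd ((e , M) ∷ (e′ , M′) ∷ L) φ ≈ weightProd ((e , _∘ᴴ_ R M (orient p M′)) ∷ L) φ
  weightProd-parallel p M M′ L φ =
    trans (*-congˡ (*-congʳ (reflexive (orient-entry p M′ φ)))) (sym (*-assoc _ _ _))

  -- IncidentVia u a e is definitionally Parallel (punchIn u a , u) e, so orient reads
  -- the weight of e in the direction from a to the eliminated node u.
  seriesWeight : ∀ {k} {u : Fin (suc k)} {a b e₁ e₂} →
                 IncidentVia u a e₁ → IncidentVia u b e₂ → Mat R m → Mat R m → Mat R m
  seriesWeight iv₁ iv₂ M₁ M₂ = _*ᴹ_ R (orient iv₁ M₁) (_ᵀ R (orient iv₂ M₂))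

  weightProd-series : ∀ {k} {u : Fin (suc k)} {a b e₁ e₂}
                      (iv₁ : IncidentVia u a e₁) (iv₂ : IncidentVia u b e₂) M₁ M₂ L (ψ : Valuation k) →
                      sumFin R (λ v → weightProd ((e₁ , M₁) ∷ (e₂ , M₂) ∷ map (relabel (punchIn u)) L)
                                                 (insertAt ψ u v))
                      ≈ weightProd (((a , b) , seriesWeight iv₁ iv₂ M₁ M₂) ∷ L) ψ
  weightProd-series {u = u} {a} {b} iv₁ iv₂ M₁ M₂ L ψ = begin
    sumFin R (λ v → weightProd ((_ , M₁) ∷ (_ , M₂) ∷ map (relabel (punchIn u)) L) (insertAt ψ u v))
      ≈⟨ sumFin-cong (λ v → trans (reflexive (cong₂ _*_ (towardsInserted iv₁ M₁ v)
                                                   (cong₂ _*_ (towardsInserted iv₂ M₂ v) (restInserted v))))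
                                  (sym (*-assoc _ _ _))) ⟩
    sumFin R (λ v → (orient iv₁ M₁ (ψ a) v * orient iv₂ M₂ (ψ b) v) * weightProd L ψ)
      ≈⟨ sumFin-*ʳ (weightProd L ψ) (λ v → orient iv₁ M₁ (ψ a) v * orient iv₂ M₂ (ψ b) v) ⟩
    weightProd (((a , b) , seriesWeight iv₁ iv₂ M₁ M₂) ∷ L) ψ ∎
    where
    towardsInserted : ∀ {c e} (iv : IncidentVia u c e) M v →
                      M (insertAt ψ u v (proj₁ e)) (insertAt ψ u v (proj₂ e)) ≡ orient iv M (ψ c) v
    towardsInserted {c} iv M v = ≡.trans (orient-entry iv M (insertAt ψ u v))
                                         (cong₂ (orient iv M) (insertAt-punchIn ψ u v c) (insertAt-lookup ψ u v))
    restInserted : ∀ v → weightProd (map (relabel (punchIn u)) L) (insertAt ψ u v) ≡ weightProd L ψ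
    restInserted v = ≡.trans (weightProd-relabel (punchIn u) L (insertAt ψ u v))
                             (weightProd-cong L (insertAt-punchIn ψ u v))

K₂ : TTGraph
K₂ = mkG 2 ((zero , suc zero) ∷ []) zero (suc zero)

K₂-isSeriesParallel : IsSeriesParallel K₂
K₂-isSeriesParallel = K₂ , ε , refl , λ ()

module CoherentAlgebraProperties {c ℓ ℓa} (R : CommutativeRing c ℓ) (ι : Involution R) (m : ℕ)
                                 (A : Mat R m → Set ℓa) (isCoherent : IsCoherentAlgebra R ι m A) where
  open CommutativeRing R hiding (zero) renaming (refl to ≈-refl)
  open IsCoherentAlgebra isCoherent
  open FiniteSums R
  open RootedSums R m
  open SetoidReasoning setoid

  sumᴹ∈ : ∀ k (f : Fin k → Mat R m) → (∀ i → A (f i)) → A (sumᴹ R f)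
  sumᴹ∈ zero    f f∈ = 0∈
  sumᴹ∈ (suc k) f f∈ = +∈ (f∈ zero) (sumᴹ∈ k (f ∘ suc) (f∈ ∘ suc))

  orient∈ : ∀ {k} {d e : Fin k × Fin k} (p : Parallel d e) {M} → A M → A (orient p M)
  orient∈ (inj₁ _) M∈ = M∈
  orient∈ (inj₂ _) M∈ = ᵀ∈ M∈

  diagJ∈ : ∀ {M} → A M → A (λ x y → M x x)
  diagJ∈ {M} M∈ = resp spread (*∈ (∘∈ I∈ M∈) J∈)
    where
    spread : _≈ᴹ_ R (_*ᴹ_ R (_∘ᴴ_ R (Iᴹ R) M) (Jᴹ R)) (λ x y → M x x)
    spread x y = trans (sumFin-cong {k = m} (λ j → trans (*-identityʳ _) (*-congʳ (δ-sym x j))))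
                       (sumFin-δ (M x) x)

  Jdiag∈ : ∀ {M} → A M → A (λ x y → M y y)
  Jdiag∈ {M} M∈ = resp spread (*∈ J∈ (∘∈ I∈ M∈))
    where
    spread : _≈ᴹ_ R (_*ᴹ_ R (Jᴹ R) (_∘ᴴ_ R (Iᴹ R) M)) (λ x y → M y y)
    spread x y = trans (sumFin-cong {k = m} (λ j → *-identityˡ _)) (sumFin-δ (λ j → M j y) y)

  pairEntries∈ : ∀ p q {M} → A M → A (λ x y → M (pair x y p) (pair x y q))
  pairEntries∈ zero       zero       M∈ = diagJ∈ M∈
  pairEntries∈ zero       (suc zero) M∈ = M∈
  pairEntries∈ (suc zero) zero       M∈ = ᵀ∈ M∈
  pairEntries∈ (suc zero) (suc zero) M∈ = Jdiag∈ M∈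

  weightProd-pair∈ : ∀ {L : List (WeightedEdge 2)} → All (A ∘ proj₂) L → A (λ x y → weightProd L (pair x y))
  weightProd-pair∈                     []        = J∈
  weightProd-pair∈ {((p , q) , _) ∷ _} (M∈ ∷ L∈) = ∘∈ (pairEntries∈ p q M∈) (weightProd-pair∈ L∈)

  rootedSum₂∈ : ∀ (s₁ s₂ : Fin 2) → s₁ ≢ s₂ → ∀ {L} → All (A ∘ proj₂) L → A (rootedSum 2 s₁ s₂ (weightProd L))
  rootedSum₂∈ zero       zero       s₁≢s₂ L∈ = contradiction refl s₁≢s₂
  rootedSum₂∈ (suc zero) (suc zero) s₁≢s₂ L∈ = contradiction refl s₁≢s₂
  rootedSum₂∈ zero       (suc zero) _ {L} L∈ =
    resp (λ x y → sym (rootedSum-two (weightProd-ext L) x y)) (weightProd-pair∈ L∈)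
  rootedSum₂∈ (suc zero) zero       _ {L} L∈ =
    resp (λ x y → sym (trans (rootedSum-swap 2 zero (suc zero) (weightProd L) x y)
                             (rootedSum-two (weightProd-ext L) y x)))
         (ᵀ∈ (weightProd-pair∈ L∈))

  zipWeights∈ : ∀ {k} (E : List (Fin k × Fin k)) {w} → (∀ i → A (w i)) → All (A ∘ proj₂) (zipWeights E w)
  zipWeights∈ []      w∈ = []
  zipWeights∈ (e ∷ E) w∈ = w∈ zero ∷ zipWeights∈ E (w∈ ∘ suc)

  record Weighting (G : TTGraph) : Set (c ⊔ ℓa) where
    constructor weighting
    field
      wedges   : List (WeightedEdge (n G))
      keys≡    : keys wedges ≡ edges G
      weights∈ : All (A ∘ proj₂) wedges

  value : ∀ {G} → Weighting G → Mat R m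
  value {G} L = rootedSum (n G) (r₁ G) (r₂ G) (weightProd (Weighting.wedges L))

  Reweighting : ∀ {G} → TTGraph → Weighting G → Set (c ⊔ ℓ ⊔ ℓa)
  Reweighting H L = Σ (Weighting H) λ L′ → _≈ᴹ_ R (value L) (value L′)

  bringToFront : ∀ {k} {L : List (WeightedEdge k)} {E e e′ K} → keys L ≡ E → E ↭ e ∷ e′ ∷ K →
                 Σ (Mat R m) λ M → Σ (Mat R m) λ M′ → Σ (List (WeightedEdge k)) λ L′ →
                 L ↭ (e , M) ∷ (e′ , M′) ∷ L′ × keys L′ ≡ K
  bringToFront refl E↭ with ↭-map-inv proj₁ E↭
  ... | L₁ , keys₁ , L↭L₁ with ∷-keys-inv (≡.sym keys₁)
  ... | M , L₂ , refl , keys₂ with ∷-keys-inv keys₂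
  ... | M′ , L′ , refl , keys′ = M , M′ , L′ , L↭L₁ , keys′

  reduce : ∀ {G H} → Reduction G H → (L : Weighting G) → Reweighting H L
  reduce (parallel {n} E E′ e e′ s₁ s₂ par E↭) (weighting L keys≡ L∈)
    with bringToFront keys≡ E↭
  ... | M , M′ , L′ , L↭ , keys′ with All-resp-↭ L↭ L∈
  ... | M∈ ∷ M′∈ ∷ L′∈ =
    weighting ((e , _∘ᴴ_ R M (orient par M′)) ∷ L′) (cong (e ∷_) keys′) (∘∈ M∈ (orient∈ par M′∈) ∷ L′∈) ,
    rootedSum-cong n s₁ s₂ (λ φ → trans (weightProd-↭ L↭ φ) (weightProd-parallel par M M′ L′ φ))
  reduce (series {n} u a b r₁′ r₂′ E E′ e₁ e₂ iv₁ iv₂ E↭) (weighting L keys≡ L∈)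
    with bringToFront keys≡ E↭
  ... | M₁ , M₂ , L₂ , L↭ , keys₂ with keys-relabel-inv (punchIn u) E′ keys₂ | All-resp-↭ L↭ L∈
  ... | L′ , keys′ , refl | M₁∈ ∷ M₂∈ ∷ L₂∈ =
    weighting (((a , b) , seriesWeight iv₁ iv₂ M₁ M₂) ∷ L′) (cong ((a , b) ∷_) keys′)
              (*∈ (orient∈ iv₁ M₁∈) (ᵀ∈ (orient∈ iv₂ M₂∈)) ∷ map⁻ L₂∈) ,
    λ x y → begin
      rootedSum (suc n) (punchIn u r₁′) (punchIn u r₂′) (weightProd L) x y
        ≈⟨ rootedSum-cong (suc n) (punchIn u r₁′) (punchIn u r₂′) (weightProd-↭ L↭) x y ⟩
      rootedSum (suc n) (punchIn u r₁′) (punchIn u r₂′) (weightProd L₁) x y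
        ≈⟨ rootedSum-insertAt n u r₁′ r₂′ (weightProd-ext L₁) x y ⟩
      rootedSum n r₁′ r₂′ (λ ψ → sumFin R (λ v → weightProd L₁ (insertAt ψ u v))) x y
        ≈⟨ rootedSum-cong n r₁′ r₂′ (weightProd-series iv₁ iv₂ M₁ M₂ L′) x y ⟩
      rootedSum n r₁′ r₂′ (weightProd (((a , b) , seriesWeight iv₁ iv₂ M₁ M₂) ∷ L′)) x y ∎
    where
    L₁ : List (WeightedEdge (suc n))
    L₁ = (e₁ , M₁) ∷ (e₂ , M₂) ∷ map (relabel (punchIn u)) L′

  reduce* : ∀ {G H} → Star Reduction G H → (L : Weighting G) → Reweighting H L
  reduce* ε        L = L , λ x y → ≈-refl
  reduce* (r ◅ rs) L with reduce r L
  ... | L₁ , L≈L₁ with reduce* rs L₁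
  ... | L₂ , L₁≈L₂ = L₂ , λ x y → trans (L≈L₁ x y) (L₁≈L₂ x y)

  value∈ : ∀ {H} → n H ≡ 2 → r₁ H ≢ r₂ H → (L : Weighting H) → A (value L)
  value∈ {mkG _ _ s₁ s₂} refl s₁≢s₂ L = rootedSum₂∈ s₁ s₂ s₁≢s₂ (Weighting.weights∈ L)

  fromWeights : ∀ {G} (w : Weights R m G) → (∀ e → A (w e)) → Weighting G
  fromWeights {G} w w∈ = weighting (zipWeights (edges G) w) (keys-zipWeights (edges G) w) (zipWeights∈ (edges G) w∈)

  S≈value-fromWeights : ∀ {G} (w : Weights R m G) (w∈ : ∀ e → A (w e)) →
                        _≈ᴹ_ R (S R G w) (value (fromWeights {G} w w∈))
  S≈value-fromWeights {G} w w∈ =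
    rootedSum-cong (n G) (r₁ G) (r₂ G) (λ φ → reflexive (edgeProd≡weightProd (edges G) w φ))

  S∈ : ∀ {G} → IsSeriesParallel G → (w : Weights R m G) → (∀ e → A (w e)) → A (S R G w)
  S∈ {G} (H , steps , n≡2 , r₁≢r₂) w w∈ with reduce* steps (fromWeights {G} w w∈)
  ... | L , value≈ =
    resp (λ x y → sym (trans (S≈value-fromWeights {G} w w∈ x y) (value≈ x y))) (value∈ n≡2 r₁≢r₂ L)

  W⊆A : ∀ G → IsSeriesParallel G → ∀ M → W R m G A M → A M
  W⊆A G sp M (k , coef , ws , ws∈ , M≈) =
    resp (λ x y → sym (M≈ x y)) (sumᴹ∈ k _ (λ i → ·∈ (coef i) (S∈ sp (ws i) (ws∈ i))))

  S-K₂ : ∀ M → _≈ᴹ_ R (S R K₂ (λ _ → M)) M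
  S-K₂ M x y = trans (rootedSum-two edgeEntry-ext x y) (*-identityʳ (M x y))
    where
    edgeEntry-ext : (λ φ → M (φ zero) (φ (suc zero)) * 1#) Preserves _≗_ ⟶ _≈_
    edgeEntry-ext φ≗ψ = *-congʳ (reflexive (cong₂ M (φ≗ψ zero) (φ≗ψ (suc zero))))

  A⊆W : ∀ M → A M → Σ TTGraph λ G → IsSeriesParallel G × W R m G A M
  A⊆W M M∈ = K₂ , K₂-isSeriesParallel ,
    (1 , (λ _ → 1#) , (λ _ _ → M) , (λ _ _ → M∈) ,
     λ x y → sym (trans (+-identityʳ _) (trans (*-identityˡ _) (S-K₂ M x y))))

theorem4p18 : ∀ {c ℓ ℓa} (R : CommutativeRing c ℓ) (ι : Involution R)
    (m : ℕ) (A : Mat R m → Set ℓa) → IsCoherentAlgebra R ι m A →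
    (∀ M → A M → Σ TTGraph λ G → IsSeriesParallel G × W R m G A M)
    × (∀ G → IsSeriesParallel G → ∀ M → W R m G A M → A M)
theorem4p18 R ι m A isCoherent = A⊆W , W⊆A
  where open CoherentAlgebraProperties R ι m A isCoherent
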